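{- For non-negative integers $a,b$, let $f_{a,b}(q)=\sum_\lambda q^{|\lambda|}$, summed over partitions $\lambda$ with distinct parts, largest part at most $b$, and $2$-core equal to $(a,a-1,\dots,1)$ (the empty partition if $a=0$). Then \[ f_{a,b}(q)=\left[{b \atop \lfloor \frac{b-a}{2} \rfloor}\right]_{q^2}q^{\binom{a+1}{2}}. \]
   Context: The $2$-core of a partition is obtained by repeatedly removing dominoes (rim hooks of length $2$) whose removal leaves a Young diagram until none remain; it is well defined. $\left[{x\atop y}\right]_{q^2}$ is the Gaussian binomial coefficient in the variable $q^2$, equal to $0$ if $y<0$ or $y>x$. -}

module Defs where

open import Data.Nat using (ℕ; zero; suc; _+_; _*_; _^_; _≤_; _>_)
open import Data.Integer using (ℤ; +_; -[1+_])
open import Data.List using (List; []; _∷_)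
open import Data.Nat.ListAction using (sum)
open import Data.List.Relation.Unary.All using (All)
open import Data.List.Relation.Unary.Linked using (Linked)
open import Data.Product using (_×_)
open import Relation.Binary.Construct.Closure.ReflexiveTransitive using (Star)
open import Relation.Nullary using (¬_)

-- A partition is a list of positive parts in weakly decreasing order,
-- e.g. (3 ∷ 1 ∷ 1 ∷ []).  Its size |λ| is the sum of the parts.
size : List ℕ → ℕ
size = sum

hd : List ℕ → ℕ
hd []      = 0
hd (x ∷ _) = x

-- prepend a part, dropping it if it is 0 (it is then the last part)
_∷⁺_ : ℕ → List ℕ → List ℕ
zero    ∷⁺ xs = xs
(suc x) ∷⁺ xs = suc x ∷ xs

-- One domino removal: remove a rim hook of length 2 so that what remains is
-- again a Young diagram.
--  horizontal: the last two cells of a row i (needs λ_i - 2 ≥ λ_{i+1});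
--  vertical: the last cells of rows i and i+1 in the same column
--            (needs λ_i = λ_{i+1} and λ_{i+1} - 1 ≥ λ_{i+2}).
data DominoStep : List ℕ → List ℕ → Set where
  horiz : ∀ {x xs} → hd xs ≤ x → DominoStep (suc (suc x) ∷ xs) (x ∷⁺ xs)
  vert  : ∀ {x xs} → hd xs ≤ x → DominoStep (suc x ∷ suc x ∷ xs) (x ∷⁺ (x ∷⁺ xs))
  there : ∀ {x xs ys} → DominoStep xs ys → DominoStep (x ∷ xs) (x ∷ ys)

TwoCore : List ℕ → List ℕ → Set
TwoCore λ' μ = Star DominoStep λ' μ × (∀ ν → ¬ DominoStep μ ν)

staircase : ℕ → List ℕ
staircase zero    = []
staircase (suc a) = suc a ∷ staircase a

DistinctPartsAtMost : ℕ → List ℕ → Set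
DistinctPartsAtMost b λ' = Linked _>_ λ' × All (λ x → 1 ≤ x × x ≤ b) λ'

-- Gaussian binomial [n choose k]_x evaluated at x : ℕ, via q-Pascal:
-- [n+1, k+1] = [n, k] + x^(k+1) [n, k+1]
gauss : ℕ → ℕ → ℕ → ℕ
gauss x zero    zero    = 1
gauss x zero    (suc k) = 0
gauss x (suc n) zero    = 1
gauss x (suc n) (suc k) = gauss x n k + x ^ suc k * gauss x n (suc k)

gaussℤ : ℕ → ℕ → ℤ → ℕ
gaussℤ x n (+ k)     = gauss x n k
gaussℤ x n -[1+ k ]  = 0

module Submission where

-- Write p(n) ∈ {0,1} for the parity of n and let the charge of a partition be
-- c(λ) = p(λ₁) − p(λ₂) + p(λ₃) − ⋯ .  Domino removal preserves the charge,
-- every partition reduces to a staircase, staircases admit no domino removal,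
-- and a ↦ c(staircase a) is injective (indeed a bijection ℕ ≃ ℤ).  Hence λ has
-- 2-core staircase a iff c(λ) = c(staircase a).
--
-- Strict partitions with parts ≤ b and charge d are enumerated without
-- repetition by recursion on b (is b+1 the largest part or not?), which gives
--   f_{b+1,a} = f_{b,a} + q^{b+1} f_{b,a′},  a′ = a+1 if b ≡ a (mod 2), else max(a−1, 0),
-- with f_{0,a} = [a = 0].  The closed form satisfies the same recurrence, by the
-- two q-Pascal rules and the symmetry of Gaussian binomials, so both agree by
-- induction on b.  Finally L and the enumeration are duplicate-free lists with
-- the same members, so their weights agree.

open import Defs
open import Data.Nat as ℕ using (ℕ; zero; suc; pred; _+_; _*_; _^_; _∸_; _≤_; _<_; _>_; z≤n; s≤s)
import Data.Nat.Properties as ℕₚ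
import Data.Nat.Tactic.RingSolver as ℕ-Solver
open import Data.Nat.DivMod as DivMod using (_/_)
open import Data.Nat.Combinatorics using (_C_; nCk+nC[k+1]≡[n+1]C[k+1]; nC1≡n)
open import Data.Nat.ListAction using (sum)
import Data.Nat.ListAction.Properties as Sumₚ
open import Data.Integer as ℤ using (ℤ; +_; -[1+_]; _-_; _/ℕ_)
import Data.Integer.Properties as ℤₚ
open import Data.Integer.DivMod using ([n/ℕd]*d≤n)
import Data.Integer.Tactic.RingSolver as ℤ-Solver
open import Data.List using (List; []; _∷_; _++_; map)
import Data.List.Properties as Listₚ
open import Data.List.Relation.Unary.All as All using (All; []; _∷_)
open import Data.List.Relation.Unary.Any using (here)
open import Data.List.Relation.Unary.Linked using (Linked; []; [-]; _∷_)
open import Data.List.Relation.Unary.AllPairs using ([]; _∷_)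
open import Data.List.Relation.Unary.Unique.Propositional using (Unique)
import Data.List.Relation.Unary.Unique.Propositional.Properties as Uniqueₚ
open import Data.List.Membership.Propositional using (_∈_)
open import Data.List.Membership.Propositional.Properties using (∈-++⁻; ∈-++⁺ˡ; ∈-++⁺ʳ; ∈-map⁻; ∈-map⁺)
open import Data.List.Membership.Propositional.Properties.WithK using (unique∧set⇒bag)
open import Data.List.Relation.Binary.BagAndSetEquality using (∼bag⇒↭)
import Data.List.Relation.Binary.Permutation.Propositional.Properties as Permₚ
open import Data.Product using (_×_; _,_; ∃-syntax)
open import Data.Sum using (_⊎_; inj₁; inj₂)
open import Data.Empty using (⊥-elim)
open import Function.Bundles using (_⇔_; mk⇔; Equivalence)
open import Relation.Nullary using (¬_; yes; no)
open import Relation.Binary.PropositionalEquality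
open import Relation.Binary.Definitions using (tri<; tri≈; tri>)
open import Relation.Binary.Construct.Closure.ReflexiveTransitive using (Star; ε; _◅_)

-- 2n, by a recursion that lets parity arguments compute
double : ℕ → ℕ
double zero    = zero
double (suc n) = suc (suc (double n))

data EvenOdd : ℕ → Set where
  even : ∀ m → EvenOdd (double m)
  odd  : ∀ m → EvenOdd (suc (double m))

evenOdd : ∀ n → EvenOdd n
evenOdd zero = even zero
evenOdd (suc n) with evenOdd n
... | even m = odd m
... | odd m  = even (suc m)

double≡+ : ∀ k → double k ≡ k + k
double≡+ zero    = refl
double≡+ (suc k) = cong suc (trans (cong suc (double≡+ k)) (sym (ℕₚ.+-suc k k)))

parity : ℕ → ℤ
parity zero          = + 0
parity (suc zero)    = + 1
parity (suc (suc n)) = parity n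

parity-double : ∀ m → parity (double m) ≡ + 0
parity-double zero    = refl
parity-double (suc m) = parity-double m

parity-odd : ∀ m → parity (suc (double m)) ≡ + 1
parity-odd zero    = refl
parity-odd (suc m) = parity-odd m

parity-double+ : ∀ k n → parity (double k + n) ≡ parity n
parity-double+ zero    n = refl
parity-double+ (suc k) n = parity-double+ k n

parity-suc : ∀ n → parity (suc n) ≡ + 1 - parity n
parity-suc zero          = refl
parity-suc (suc zero)    = refl
parity-suc (suc (suc n)) = parity-suc n

parity-suc-cong : ∀ m n → parity m ≡ parity n → parity (suc m) ≡ parity (suc n)
parity-suc-cong m n e = trans (parity-suc m) (trans (cong (+ 1 -_) e) (sym (parity-suc n)))

parity-suc-≢ : ∀ n → parity (suc n) ≢ parity n
parity-suc-≢ zero          ()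
parity-suc-≢ (suc zero)    ()
parity-suc-≢ (suc (suc n)) = parity-suc-≢ n

parity-shift : ∀ k n → parity (suc (double k + n)) ≡ parity (suc n)
parity-shift k n = parity-suc-cong (double k + n) n (parity-double+ k n)

parity-dichotomy : ∀ b a → parity b ≡ parity a ⊎ parity b ≡ parity (suc a)
parity-dichotomy b a with evenOdd b | evenOdd a
... | even m | even n = inj₁ (trans (parity-double m) (sym (parity-double n)))
... | even m | odd n  = inj₂ (trans (parity-double m) (sym (parity-double n)))
... | odd m  | even n = inj₂ (trans (parity-odd m) (sym (parity-odd n)))
... | odd m  | odd n  = inj₁ (trans (parity-odd m) (sym (parity-odd n)))

data IsPartition : List ℕ → Set where
  []   : IsPartition []
  cons : ∀ {x xs} → 1 ≤ x → hd xs ≤ x → IsPartition xs → IsPartition (x ∷ xs)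

charge : List ℕ → ℤ
charge []       = + 0
charge (x ∷ xs) = parity x - charge xs

-- u − (u − v) = v: appending and removing a part leave the charge unchanged
cancel : ∀ u v → u - (u - v) ≡ v
cancel = ℤ-Solver.solve-∀

hd-∷⁺ : ∀ {x xs} → hd xs ≤ x → hd (x ∷⁺ xs) ≤ x
hd-∷⁺ {zero}  h = h
hd-∷⁺ {suc x} h = ℕₚ.≤-refl

∷⁺-partition : ∀ {x xs} → hd xs ≤ x → IsPartition xs → IsPartition (x ∷⁺ xs)
∷⁺-partition {zero}  h p = p
∷⁺-partition {suc x} h p = cons (s≤s z≤n) h p

hd-step : ∀ {xs ys} → DominoStep xs ys → hd ys ≤ hd xs
hd-step (horiz h) = ℕₚ.m≤n⇒m≤1+n (ℕₚ.m≤n⇒m≤1+n (hd-∷⁺ h))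
hd-step (vert h)  = ℕₚ.m≤n⇒m≤1+n (hd-∷⁺ (hd-∷⁺ h))
hd-step (there s) = ℕₚ.≤-refl

step-partition : ∀ {xs ys} → DominoStep xs ys → IsPartition xs → IsPartition ys
step-partition (horiz h) (cons _ _ p)            = ∷⁺-partition h p
step-partition (vert h)  (cons _ _ (cons _ _ p)) = ∷⁺-partition (hd-∷⁺ h) (∷⁺-partition h p)
step-partition (there s) (cons x≥1 h p)          = cons x≥1 (ℕₚ.≤-trans (hd-step s) h) (step-partition s p)

-- a dropped zero part is the last one, so it does not disturb the charge
charge-∷⁺ : ∀ {x xs} → hd xs ≤ x → IsPartition xs → charge (x ∷⁺ xs) ≡ parity x - charge xs
charge-∷⁺ {zero}  h []             = refl
charge-∷⁺ {zero}  h (cons x≥1 _ _) = ⊥-elim (ℕₚ.<⇒≱ x≥1 h)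
charge-∷⁺ {suc x} h p              = refl

-- a horizontal domino keeps the parity of its row; a vertical one changes
-- the parities of two adjacent rows, whose contributions cancel
charge-step : ∀ {xs ys} → DominoStep xs ys → IsPartition xs → charge ys ≡ charge xs
charge-step (horiz h) (cons _ _ p) = charge-∷⁺ h p
charge-step (vert {x} {xs} h) (cons _ _ (cons _ _ p)) = begin
  charge (x ∷⁺ (x ∷⁺ xs))                       ≡⟨ charge-∷⁺ (hd-∷⁺ h) (∷⁺-partition h p) ⟩
  parity x - charge (x ∷⁺ xs)                   ≡⟨ cong (parity x -_) (charge-∷⁺ h p) ⟩
  parity x - (parity x - charge xs)             ≡⟨ cancel (parity x) (charge xs) ⟩
  charge xs                                     ≡⟨ cancel (parity (suc x)) (charge xs) ⟨
  parity (suc x) - (parity (suc x) - charge xs) ∎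
  where open ≡-Reasoning
charge-step (there {x} s) (cons _ _ p) = cong (parity x -_) (charge-step s p)

charge-reduction : ∀ {xs ys} → Star DominoStep xs ys → IsPartition xs → charge ys ≡ charge xs
charge-reduction ε        p = refl
charge-reduction (s ◅ ss) p = trans (charge-reduction ss (step-partition s p)) (charge-step s p)

size-∷⁺ : ∀ x xs → size (x ∷⁺ xs) ≡ x + size xs
size-∷⁺ zero    xs = refl
size-∷⁺ (suc x) xs = refl

-- a domino has two cells; this makes domino removal terminate
size-step : ∀ {xs ys} → DominoStep xs ys → size xs ≡ 2 + size ys
size-step (horiz {x} {xs} h) = cong (λ s → 2 + s) (sym (size-∷⁺ x xs))
size-step (vert {x} {xs} h) = begin
  suc x + (suc x + size xs)   ≡⟨ cong suc (ℕₚ.+-suc x (x + size xs)) ⟩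
  2 + (x + (x + size xs))     ≡⟨ cong (λ s → 2 + (x + s)) (size-∷⁺ x xs) ⟨
  2 + (x + size (x ∷⁺ xs))    ≡⟨ cong (λ s → 2 + s) (size-∷⁺ x (x ∷⁺ xs)) ⟨
  2 + size (x ∷⁺ (x ∷⁺ xs))   ∎
  where open ≡-Reasoning
size-step (there {x} {xs} {ys} s) = begin
  x + size xs        ≡⟨ cong (λ s → x + s) (size-step s) ⟩
  x + (2 + size ys)  ≡⟨ ℕₚ.+-comm x (2 + size ys) ⟩
  2 + size ys + x    ≡⟨ cong (λ s → 2 + s) (ℕₚ.+-comm (size ys) x) ⟩
  2 + (x + size ys)  ∎
  where open ≡-Reasoning

hd-staircase : ∀ k → hd (staircase k) ≡ k
hd-staircase zero    = refl
hd-staircase (suc k) = refl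

data Progress : List ℕ → Set where
  step : ∀ {xs ys} → DominoStep xs ys → Progress xs
  done : ∀ a → Progress (staircase a)

-- a part x ≥ k on top of staircase k: x = k+1 extends the staircase,
-- x = k gives a vertical domino, x ≥ k+2 a horizontal one
progress-on-staircase : ∀ x k → 1 ≤ x → k ≤ x → Progress (x ∷ staircase k)
progress-on-staircase (suc zero)    zero    _ _ = done 1
progress-on-staircase (suc (suc x)) zero    _ _ = step (horiz {x} {[]} z≤n)
progress-on-staircase (suc x) (suc k) _ (s≤s k≤x) with ℕₚ.<-cmp x (suc k)
... | tri< x≤k _ _ with ℕₚ.≤-antisym (ℕₚ.≤-pred x≤k) k≤x
...   | refl = step (vert {x} {staircase x} (ℕₚ.≤-reflexive (hd-staircase x)))
progress-on-staircase (suc x) (suc k) _ _ | tri≈ _ refl _ = done (suc (suc k))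
progress-on-staircase (suc (suc y)) (suc k) _ _ | tri> _ _ (s≤s k<y) =
  step (horiz {y} {suc k ∷ staircase k} k<y)

progress : ∀ {xs} → IsPartition xs → Progress xs
progress [] = done 0
progress (cons x≥1 h p) with progress p
... | step s = step (there s)
... | done k = progress-on-staircase _ k x≥1 (subst (_≤ _) (hd-staircase k) h)

-- removing dominoes as long as possible ends in a staircase (n bounds the size)
reduce : ∀ n {xs} → size xs ≤ n → IsPartition xs → ∃[ a ] Star DominoStep xs (staircase a)
reduce n le p with progress p
... | done a = a , ε
reduce zero    le p | step s = ⊥-elim (ℕₚ.n≮0 (subst (_≤ 0) (size-step s) le))
reduce (suc n) le p | step s with reduce n (ℕₚ.<⇒≤ (ℕₚ.≤-pred (subst (_≤ suc n) (size-step s) le))) (step-partition s p)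
... | a , ss = a , s ◅ ss

-- no domino can be removed from a staircase: consecutive parts differ by exactly 1
staircase-stuck : ∀ a {ν} → ¬ DominoStep (staircase a) ν
staircase-stuck zero          ()
staircase-stuck (suc zero)    (there ())
staircase-stuck (suc (suc a)) (horiz h) = ℕₚ.<-irrefl refl h
staircase-stuck (suc (suc a)) (there s) = staircase-stuck (suc a) s

coreCharge : ℕ → ℤ
coreCharge a = charge (staircase a)

coreCharge-even : ∀ m → coreCharge (double m) ≡ ℤ.- (+ m)
coreCharge-odd  : ∀ m → coreCharge (suc (double m)) ≡ + suc m
coreCharge-even zero    = refl
coreCharge-even (suc m) = cong₂ _-_ (parity-double (suc m)) (coreCharge-odd m)
coreCharge-odd m = begin
  parity (suc (double m)) - coreCharge (double m) ≡⟨ cong₂ _-_ (parity-odd m) (coreCharge-even m) ⟩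
  + 1 - ℤ.- (+ m)                                 ≡⟨ cong (λ z → + 1 ℤ.+ z) (ℤₚ.neg-involutive (+ m)) ⟩
  + suc m                                         ∎
  where open ≡-Reasoning

-- the inverse of coreCharge, so that 2-cores correspond bijectively to integers
coreIndex : ℤ → ℕ
coreIndex (+ zero)  = zero
coreIndex (+ suc m) = suc (double m)
coreIndex -[1+ m ]  = double (suc m)

coreIndex-coreCharge : ∀ a → coreIndex (coreCharge a) ≡ a
coreIndex-coreCharge a with evenOdd a
... | even zero    = refl
... | even (suc m) = cong coreIndex (coreCharge-even (suc m))
... | odd m        = cong coreIndex (coreCharge-odd m)

coreCharge-injective : ∀ {a b} → coreCharge a ≡ coreCharge b → a ≡ b
coreCharge-injective {a} {b} e = begin
  a                         ≡⟨ coreIndex-coreCharge a ⟨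
  coreIndex (coreCharge a)  ≡⟨ cong coreIndex e ⟩
  coreIndex (coreCharge b)  ≡⟨ coreIndex-coreCharge b ⟩
  b                         ∎
  where open ≡-Reasoning

twoCore⇒charge : ∀ {ν a} → IsPartition ν → TwoCore ν (staircase a) → charge ν ≡ coreCharge a
twoCore⇒charge p (reduction , _) = sym (charge-reduction reduction p)

charge⇒twoCore : ∀ {ν a} → IsPartition ν → charge ν ≡ coreCharge a → TwoCore ν (staircase a)
charge⇒twoCore {ν} {a} p e with reduce (size ν) ℕₚ.≤-refl p
... | a′ , reduction with coreCharge-injective {a′} {a} (trans (charge-reduction reduction p) e)
...   | refl = reduction , λ _ → staircase-stuck a′

distinct⇒partition : ∀ {b ν} → DistinctPartsAtMost b ν → IsPartition ν
distinct⇒partition {ν = []}        _                             = []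
distinct⇒partition {ν = x ∷ []}    (_ , ((x≥1 , _) ∷ _))         = cons x≥1 z≤n []
distinct⇒partition {ν = x ∷ y ∷ ν} (x>y ∷ lk , ((x≥1 , _) ∷ bd)) = cons x≥1 (ℕₚ.<⇒≤ x>y) (distinct⇒partition (lk , bd))

-- strict b d lists the strict partitions with parts ≤ b and charge d:
-- those without the part b+1, then those with largest part b+1
strict : ℕ → ℤ → List (List ℕ)
strict zero    (+ zero) = [] ∷ []
strict zero    _        = []
strict (suc b) d = strict b d ++ map (suc b ∷_) (strict b (parity (suc b) - d))

Bounded : ℕ → List ℕ → Set
Bounded b = All (λ x → 1 ≤ x × x ≤ b)

bounded-suc : ∀ {b ν} → Bounded b ν → Bounded (suc b) ν
bounded-suc = All.map (λ (x≥1 , x≤b) → x≥1 , ℕₚ.m≤n⇒m≤1+n x≤b)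

below-head : ∀ {x ν} → Linked _>_ (x ∷ ν) → All (_< x) ν
below-head [-]        = []
below-head (x>y ∷ lk) = x>y ∷ All.map (λ z<y → ℕₚ.<-trans z<y x>y) (below-head lk)

linked-cons : ∀ {x ν} → All (_< x) ν → Linked _>_ ν → Linked _>_ (x ∷ ν)
linked-cons []        _  = [-]
linked-cons (y<x ∷ _) lk = y<x ∷ lk

linked-tail : ∀ {x ν} → Linked _>_ (x ∷ ν) → Linked _>_ ν
linked-tail [-]      = []
linked-tail (_ ∷ lk) = lk

strict⇒ : ∀ b d ν → ν ∈ strict b d → DistinctPartsAtMost b ν × charge ν ≡ d
strict⇒ zero (+ zero) .[] (here refl) = ([] , []) , refl
strict⇒ (suc b) d ν ν∈ with ∈-++⁻ (strict b d) ν∈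
... | inj₁ ν∈′ with strict⇒ b d ν ν∈′
...   | (lk , bd) , e = (lk , bounded-suc bd) , e
strict⇒ (suc b) d ν ν∈ | inj₂ ν∈′ with ∈-map⁻ (suc b ∷_) ν∈′
... | μ , μ∈ , refl with strict⇒ b _ μ μ∈
...   | (lk , bd) , e =
  (linked-cons (All.map (λ (_ , x≤b) → s≤s x≤b) bd) lk , (s≤s z≤n , ℕₚ.≤-refl) ∷ bounded-suc bd) ,
  trans (cong (parity (suc b) -_) e) (cancel (parity (suc b)) d)

strict⇐ : ∀ b d ν → DistinctPartsAtMost b ν → charge ν ≡ d → ν ∈ strict b d
strict⇐ zero    .(+ 0) []      _                               refl = here refl
strict⇐ zero    d      (x ∷ ν) (_ , ((x≥1 , x≤0) ∷ _))         e    = ⊥-elim (ℕₚ.<⇒≱ x≥1 x≤0)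
strict⇐ (suc b) d      []      _                               e    = ∈-++⁺ˡ (strict⇐ b d [] ([] , []) e)
strict⇐ (suc b) d      (x ∷ ν) (lk , ((x≥1 , x≤1+b) ∷ bd)) e with x ℕ.≟ suc b
... | yes refl = ∈-++⁺ʳ (strict b d) (∈-map⁺ (suc b ∷_) (strict⇐ b _ ν
      (linked-tail lk , All.zipWith (λ ((y≥1 , _) , y<x) → y≥1 , ℕₚ.≤-pred y<x) (bd , below-head lk))
      (trans (sym (cancel (parity (suc b)) (charge ν))) (cong (parity (suc b) -_) e))))
... | no x≢1+b = ∈-++⁺ˡ (strict⇐ b d (x ∷ ν)
      (lk , (x≥1 , x≤b) ∷ All.zipWith (λ ((y≥1 , _) , y<x) → y≥1 , ℕₚ.≤-trans (ℕₚ.<⇒≤ y<x) x≤b) (bd , below-head lk)) e)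
  where x≤b = ℕₚ.≤-pred (ℕₚ.≤∧≢⇒< x≤1+b x≢1+b)

-- the enumeration has no repetitions: the two halves are disjoint by the largest part
strict-unique : ∀ b d → Unique (strict b d)
strict-unique zero    (+ zero)  = [] ∷ []
strict-unique zero    (+ suc n) = []
strict-unique zero    -[1+ n ]  = []
strict-unique (suc b) d = Uniqueₚ.++⁺ (strict-unique b d) (Uniqueₚ.map⁺ ∷-injectiveʳ (strict-unique b _)) disjoint
  where
  ∷-injectiveʳ : ∀ {ν μ} → suc b ∷ ν ≡ suc b ∷ μ → ν ≡ μ
  ∷-injectiveʳ refl = refl
  disjoint : ∀ {ν} → ¬ (ν ∈ strict b d × ν ∈ map (suc b ∷_) (strict b (parity (suc b) - d)))
  disjoint (ν∈ , ν∈′) with ∈-map⁻ (suc b ∷_) ν∈′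
  ... | μ , _ , refl with strict⇒ b d _ ν∈
  ...   | (_ , ((_ , 1+b≤b) ∷ _)) , _ = ℕₚ.<-irrefl refl 1+b≤b

sum-map-set-equal : ∀ {A : Set} (f : A → ℕ) {xs ys} → Unique xs → Unique ys
  → (∀ z → (z ∈ xs) ⇔ (z ∈ ys)) → sum (map f xs) ≡ sum (map f ys)
sum-map-set-equal f uxs uys same =
  Sumₚ.sum-↭ (Permₚ.map⁺ f (∼bag⇒↭ (unique∧set⇒bag uxs uys (λ {z} → same z))))

weight : ℕ → List (List ℕ) → ℕ
weight q νs = sum (map (λ ν → q ^ size ν) νs)

weight-++ : ∀ q νs μs → weight q (νs ++ μs) ≡ weight q νs + weight q μs
weight-++ q νs μs = trans (cong sum (Listₚ.map-++ _ νs μs)) (Sumₚ.sum-++ (map _ νs) _)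

weight-prepend : ∀ q c νs → weight q (map (c ∷_) νs) ≡ q ^ c * weight q νs
weight-prepend q c []       = sym (ℕₚ.*-zeroʳ (q ^ c))
weight-prepend q c (ν ∷ νs) = begin
  q ^ (c + size ν) + weight q (map (c ∷_) νs)  ≡⟨ cong₂ _+_ (ℕₚ.^-distribˡ-+-* q c (size ν)) (weight-prepend q c νs) ⟩
  q ^ c * q ^ size ν + q ^ c * weight q νs     ≡⟨ ℕₚ.*-distribˡ-+ (q ^ c) _ _ ⟨
  q ^ c * (q ^ size ν + weight q νs)           ∎
  where open ≡-Reasoning

weight-strict-suc : ∀ q b d
  → weight q (strict (suc b) d) ≡ weight q (strict b d) + q ^ suc b * weight q (strict b (parity (suc b) - d))
weight-strict-suc q b d =
  trans (weight-++ q (strict b d) _) (cong (λ w → weight q (strict b d) + w) (weight-prepend q (suc b) (strict b (parity (suc b) - d))))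

coreGenFun : ℕ → ℕ → ℕ → ℕ
coreGenFun q b a = weight q (strict b (coreCharge a))

-- the charge left for the parts below a new largest part b+1
partner-same : ∀ b a → parity b ≡ parity a → parity (suc b) - coreCharge a ≡ coreCharge (suc a)
partner-same b a e = cong (_- coreCharge a) (parity-suc-cong b a e)

partner-diff : ∀ b a → parity b ≡ parity (suc a) → parity (suc b) - coreCharge a ≡ coreCharge (pred a)
partner-diff b zero    e = cong (_- + 0) (parity-suc-cong b 1 e)
partner-diff b (suc a) e =
  trans (cong (_- coreCharge (suc a)) (parity-suc-cong b (suc (suc a)) e)) (cancel (parity (suc a)) (coreCharge a))

coreGenFun-same : ∀ q b a → parity b ≡ parity a
  → coreGenFun q (suc b) a ≡ coreGenFun q b a + q ^ suc b * coreGenFun q b (suc a)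
coreGenFun-same q b a e =
  trans (weight-strict-suc q b (coreCharge a)) (cong (λ d → coreGenFun q b a + q ^ suc b * weight q (strict b d)) (partner-same b a e))

coreGenFun-diff : ∀ q b a → parity b ≡ parity (suc a)
  → coreGenFun q (suc b) a ≡ coreGenFun q b a + q ^ suc b * coreGenFun q b (pred a)
coreGenFun-diff q b a e =
  trans (weight-strict-suc q b (coreCharge a)) (cong (λ d → coreGenFun q b a + q ^ suc b * weight q (strict b d)) (partner-diff b a e))

strict-zero-empty : ∀ q d → d ≢ + 0 → weight q (strict 0 d) ≡ 0
strict-zero-empty q (+ zero)  d≢0 = ⊥-elim (d≢0 refl)
strict-zero-empty q (+ suc n) _   = refl
strict-zero-empty q -[1+ n ]  _   = refl

gauss-zero : ∀ x n → gauss x n 0 ≡ 1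
gauss-zero x zero    = refl
gauss-zero x (suc n) = refl

gauss-above : ∀ x {n k} → n < k → gauss x n k ≡ 0
gauss-above x {zero}  {suc k} _         = refl
gauss-above x {suc n} {suc k} (s≤s n<k) = begin
  gauss x n k + x ^ suc k * gauss x n (suc k) ≡⟨ cong₂ (λ u v → u + x ^ suc k * v) (gauss-above x n<k) (gauss-above x (ℕₚ.m<n⇒m<1+n n<k)) ⟩
  x ^ suc k * 0                               ≡⟨ ℕₚ.*-zeroʳ (x ^ suc k) ⟩
  0                                           ∎
  where open ≡-Reasoning

gauss-diag : ∀ x n → gauss x n n ≡ 1
gauss-diag x zero    = refl
gauss-diag x (suc n) = begin
  gauss x n n + x ^ suc n * gauss x n (suc n) ≡⟨ cong₂ (λ u v → u + x ^ suc n * v) (gauss-diag x n) (gauss-above x (ℕₚ.n<1+n n)) ⟩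
  1 + x ^ suc n * 0                           ≡⟨ cong suc (ℕₚ.*-zeroʳ (x ^ suc n)) ⟩
  1                                           ∎
  where open ≡-Reasoning

gauss-pascal′ : ∀ x k d {n} → k + d ≡ n → gauss x (suc n) (suc k) ≡ x ^ d * gauss x n k + gauss x n (suc k)
gauss-pascal′ x k zero e with trans (sym (ℕₚ.+-identityʳ k)) e
... | refl = begin
  gauss x (suc k) (suc k)              ≡⟨ gauss-diag x (suc k) ⟩
  1                                    ≡⟨ cong₂ (λ u v → 1 * u + v) (gauss-diag x k) (gauss-above x (ℕₚ.n<1+n k)) ⟨
  1 * gauss x k k + gauss x k (suc k)  ∎
  where open ≡-Reasoning
gauss-pascal′ x zero (suc d) refl = begin
  1 + x ^ 1 * gauss x (suc d) 1                       ≡⟨ cong (λ g → 1 + x ^ 1 * g) (gauss-pascal′ x zero d refl) ⟩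
  1 + x ^ 1 * (x ^ d * gauss x d 0 + gauss x d 1)     ≡⟨ cong (λ u → 1 + x ^ 1 * (x ^ d * u + gauss x d 1)) (gauss-zero x d) ⟩
  1 + x ^ 1 * (x ^ d * 1 + gauss x d 1)               ≡⟨ rearrange x (x ^ d) (gauss x d 1) ⟩
  x * x ^ d * 1 + (1 + x ^ 1 * gauss x d 1)           ≡⟨ cong (λ u → x * x ^ d * 1 + (u + x ^ 1 * gauss x d 1)) (gauss-zero x d) ⟨
  x ^ suc d * gauss x (suc d) 0 + gauss x (suc d) 1   ∎
  where
  open ≡-Reasoning
  rearrange : ∀ x y g → 1 + x * 1 * (y * 1 + g) ≡ x * y * 1 + (1 + x * 1 * g)
  rearrange = ℕ-Solver.solve-∀
gauss-pascal′ x (suc j) (suc d) refl = begin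
  gauss x (suc m) (suc j) + x ^ suc (suc j) * gauss x (suc m) (suc (suc j))
    ≡⟨ cong₂ (λ u v → u + x ^ suc (suc j) * v) (gauss-pascal′ x j (suc d) refl) (gauss-pascal′ x (suc j) d (sym (ℕₚ.+-suc j d))) ⟩
  (x ^ suc d * A + B) + x ^ suc (suc j) * (x ^ d * B + C)
    ≡⟨ rearrange x (x ^ j) (x ^ d) A B C ⟩
  x ^ suc d * (A + x ^ suc j * B) + (B + x ^ suc (suc j) * C)
    ∎
  where
  open ≡-Reasoning
  m = j + suc d
  A = gauss x m j
  B = gauss x m (suc j)
  C = gauss x m (suc (suc j))
  rearrange : ∀ x xʲ xᵈ A B C → (x * xᵈ * A + B) + x * (x * xʲ) * (xᵈ * B + C)
                                ≡ x * xᵈ * (A + x * xʲ * B) + (B + x * (x * xʲ) * C)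
  rearrange = ℕ-Solver.solve-∀

gauss-symmetric : ∀ x k l {n} → k + l ≡ n → gauss x n k ≡ gauss x n l
gauss-symmetric x zero l refl = trans (gauss-zero x l) (sym (gauss-diag x l))
gauss-symmetric x (suc k) zero e with trans (sym (ℕₚ.+-identityʳ (suc k))) e
... | refl = gauss-diag x (suc k)
gauss-symmetric x (suc k) (suc l) refl = begin
  gauss x m k + x ^ suc k * gauss x m (suc k)
    ≡⟨ cong₂ (λ u v → u + x ^ suc k * v) (gauss-symmetric x k (suc l) refl) (gauss-symmetric x (suc k) l (sym (ℕₚ.+-suc k l))) ⟩
  gauss x m (suc l) + x ^ suc k * gauss x m l
    ≡⟨ ℕₚ.+-comm (gauss x m (suc l)) _ ⟩
  x ^ suc k * gauss x m l + gauss x m (suc l)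
    ≡⟨ gauss-pascal′ x l (suc k) (trans (ℕₚ.+-comm l (suc k)) (sym (ℕₚ.+-suc k l))) ⟨
  gauss x (suc m) (suc l) ∎
  where
  open ≡-Reasoning
  m = k + suc l

square-power : ∀ q k → (q ^ 2) ^ k ≡ q ^ double k
square-power q zero    = refl
square-power q (suc k) = trans (cong (q ^ 2 *_) (square-power q k)) (reassociate q (q ^ double k))
  where
  reassociate : ∀ q y → q * (q * 1) * y ≡ q * (q * y)
  reassociate = ℕ-Solver.solve-∀

half-double : ∀ k {r} → r < 2 → (double k + r) / 2 ≡ k
half-double zero    r<2 = DivMod.m<n⇒m/n≡0 r<2
half-double (suc k) r<2 =
  trans (DivMod.m/n≡1+[m∸n]/n {suc (suc (double k + _))} (s≤s (s≤s z≤n))) (cong suc (half-double k r<2))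

-- a negative integer has a negative quotient, where the Gaussian binomial vanishes
gaussℤ-negative : ∀ x n m → gaussℤ x n (-[1+ m ] /ℕ 2) ≡ 0
gaussℤ-negative x n m with -[1+ m ] /ℕ 2 | [n/ℕd]*d≤n -[1+ m ] 2
... | -[1+ _ ] | _  = refl
... | + k      | le with subst (ℤ._≤ -[1+ m ]) (sym (ℤₚ.pos-* k 2)) le
...   | ()

-- q^|staircase a| = q^(a+1 choose 2)
coreWeight : ℕ → ℕ → ℕ
coreWeight q a = q ^ (suc a C 2)

coreWeight-suc : ∀ q a → coreWeight q (suc a) ≡ coreWeight q a * q ^ suc a
coreWeight-suc q a = begin
  q ^ (suc (suc a) C 2)             ≡⟨ cong (q ^_) (nCk+nC[k+1]≡[n+1]C[k+1] (suc a) 1) ⟨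
  q ^ (suc a C 1 + suc a C 2)       ≡⟨ cong (λ n → q ^ (n + suc a C 2)) (nC1≡n (suc a)) ⟩
  q ^ (suc a + suc a C 2)           ≡⟨ ℕₚ.^-distribˡ-+-* q (suc a) _ ⟩
  q ^ suc a * coreWeight q a        ≡⟨ ℕₚ.*-comm (q ^ suc a) _ ⟩
  coreWeight q a * q ^ suc a        ∎
  where open ≡-Reasoning

closedForm : ℕ → ℕ → ℕ → ℕ
closedForm q b a = gaussℤ (q ^ 2) b ((+ b - + a) /ℕ 2) * coreWeight q a

closedForm-below : ∀ q k r a {b} → r < 2 → r + double k + a ≡ b → closedForm q b a ≡ gauss (q ^ 2) b k * coreWeight q a
closedForm-below q k r a r<2 refl = cong (λ z → gaussℤ (q ^ 2) (r + double k + a) z * coreWeight q a) (begin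
  (+ (r + double k + a) - + a) /ℕ 2       ≡⟨ cong (λ z → (z - + a) /ℕ 2) (ℤₚ.pos-+ (r + double k) a) ⟩
  (+ (r + double k) ℤ.+ + a - + a) /ℕ 2   ≡⟨ cong (_/ℕ 2) (cancel-right (+ (r + double k)) (+ a)) ⟩
  + ((r + double k) / 2)                  ≡⟨ cong (λ n → + (n / 2)) (ℕₚ.+-comm r (double k)) ⟩
  + ((double k + r) / 2)                  ≡⟨ cong +_ (half-double k r<2) ⟩
  + k                                     ∎)
  where
  open ≡-Reasoning
  cancel-right : ∀ u v → u ℤ.+ v - v ≡ u
  cancel-right = ℤ-Solver.solve-∀

closedForm-even : ∀ q k a {b} → double k + a ≡ b → closedForm q b a ≡ gauss (q ^ 2) b k * coreWeight q a
closedForm-even q k a = closedForm-below q k 0 a (s≤s z≤n)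

closedForm-odd : ∀ q k a {b} → suc (double k + a) ≡ b → closedForm q b a ≡ gauss (q ^ 2) b k * coreWeight q a
closedForm-odd q k a = closedForm-below q k 1 a (s≤s (s≤s z≤n))

closedForm-above : ∀ q {b a} → b < a → closedForm q b a ≡ 0
closedForm-above q {b} b<a with ℕₚ.m≤n⇒∃[o]m+o≡n b<a
... | o , refl = begin
  gaussℤ (q ^ 2) b ((+ b - + suc (b + o)) /ℕ 2) * W  ≡⟨ cong (λ z → gaussℤ (q ^ 2) b (z /ℕ 2) * W) difference ⟩
  gaussℤ (q ^ 2) b (-[1+ o ] /ℕ 2) * W               ≡⟨ cong (_* W) (gaussℤ-negative (q ^ 2) b o) ⟩
  0                                                  ∎
  where
  open ≡-Reasoning
  W = coreWeight q (suc (b + o))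
  negate-excess : ∀ u v → u - (+ 1 ℤ.+ (u ℤ.+ v)) ≡ ℤ.- (+ 1 ℤ.+ v)
  negate-excess = ℤ-Solver.solve-∀
  difference : + b - + suc (b + o) ≡ -[1+ o ]
  difference = trans (cong (λ z → + b - (+ 1 ℤ.+ z)) (ℤₚ.pos-+ b o)) (negate-excess (+ b) (+ o))

data Position : ℕ → ℕ → Set where
  below-same : ∀ k a → Position (double k + a) a
  below-diff : ∀ k a → Position (suc (double k + a)) a
  above-same : ∀ m b → Position b (suc (suc (double m + b)))
  above-diff : ∀ m b → Position b (suc (double m + b))

below : ∀ d a → Position (d + a) a
below d a with evenOdd d
... | even k = below-same k a
... | odd k  = below-diff k a

above : ∀ d b → Position b (suc (d + b))
above d b with evenOdd d
... | even m = above-diff m b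
... | odd m  = above-same m b

position : ∀ b a → Position b a
position b a with a ℕ.≤? b
... | yes a≤b = subst (λ c → Position c a) (ℕₚ.m∸n+n≡m a≤b) (below (b ∸ a) a)
... | no a≰b  = subst (Position b) (trans (sym (ℕₚ.+-suc (a ∸ suc b) b)) (ℕₚ.m∸n+n≡m (ℕₚ.≰⇒> a≰b))) (above (a ∸ suc b) b)

closedForm-vanishing : ∀ q {b a a′} → suc b < a → b < a′
  → closedForm q (suc b) a ≡ closedForm q b a + q ^ suc b * closedForm q b a′
closedForm-vanishing q {b} {a} {a′} 1+b<a b<a′ = begin
  closedForm q (suc b) a                            ≡⟨ closedForm-above q 1+b<a ⟩
  0                                                 ≡⟨ ℕₚ.*-zeroʳ (q ^ suc b) ⟨
  q ^ suc b * 0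
    ≡⟨ cong₂ (λ u v → u + q ^ suc b * v) (closedForm-above q (ℕₚ.<-trans (ℕₚ.n<1+n b) 1+b<a)) (closedForm-above q b<a′) ⟨
  closedForm q b a + q ^ suc b * closedForm q b a′  ∎
  where open ≡-Reasoning

-- the case b = a: only the first term survives
closedForm-same-diagonal : ∀ q a → closedForm q (suc a) a ≡ closedForm q a a + q ^ suc a * closedForm q a (suc a)
closedForm-same-diagonal q a = begin
  closedForm q (suc a) a                                ≡⟨ closedForm-odd q 0 a refl ⟩
  1 * W a                                               ≡⟨ cong (_* W a) (gauss-zero x a) ⟨
  gauss x a 0 * W a                                     ≡⟨ closedForm-even q 0 a refl ⟨
  closedForm q a a                                      ≡⟨ ℕₚ.+-identityʳ _ ⟨
  closedForm q a a + 0                                  ≡⟨ cong (λ v → closedForm q a a + v) (ℕₚ.*-zeroʳ (q ^ suc a)) ⟨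
  closedForm q a a + q ^ suc a * 0
    ≡⟨ cong (λ v → closedForm q a a + q ^ suc a * v) (closedForm-above q (ℕₚ.n<1+n a)) ⟨
  closedForm q a a + q ^ suc a * closedForm q a (suc a) ∎
  where
  open ≡-Reasoning
  x = q ^ 2
  W = coreWeight q

-- the case b = a + 2j + 2: the second q-Pascal rule with x^(b−j) = q^(b+1) q^(a+1)
closedForm-same-below : ∀ q j a
  → closedForm q (suc (double (suc j) + a)) a
    ≡ closedForm q (double (suc j) + a) a + q ^ suc (double (suc j) + a) * closedForm q (double (suc j) + a) (suc a)
closedForm-same-below q j a = begin
  closedForm q (suc b′) a                                   ≡⟨ closedForm-odd q (suc j) a refl ⟩
  gauss x (suc b′) (suc j) * W a                            ≡⟨ cong (_* W a) (gauss-pascal′ x j d j+d≡b′) ⟩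
  (x ^ d * gauss x b′ j + gauss x b′ (suc j)) * W a         ≡⟨ cong (λ y → (y * gauss x b′ j + gauss x b′ (suc j)) * W a) x^d≡ ⟩
  (q ^ suc b′ * q ^ suc a * gauss x b′ j + gauss x b′ (suc j)) * W a
    ≡⟨ rearrange (q ^ suc b′) (q ^ suc a) (gauss x b′ j) (gauss x b′ (suc j)) (W a) ⟩
  gauss x b′ (suc j) * W a + q ^ suc b′ * (gauss x b′ j * (W a * q ^ suc a))
    ≡⟨ cong₂ (λ u v → u + q ^ suc b′ * (gauss x b′ j * v)) (closedForm-even q (suc j) a refl) (coreWeight-suc q a) ⟨
  closedForm q b′ a + q ^ suc b′ * (gauss x b′ j * W (suc a))
    ≡⟨ cong (λ v → closedForm q b′ a + q ^ suc b′ * v) (closedForm-odd q j (suc a) (cong suc (ℕₚ.+-suc (double j) a))) ⟨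
  closedForm q b′ a + q ^ suc b′ * closedForm q b′ (suc a)  ∎
  where
  open ≡-Reasoning
  x = q ^ 2
  W = coreWeight q
  b′ = double (suc j) + a
  d = suc (suc (j + a))
  j+d≡b′ : j + d ≡ b′
  j+d≡b′ = trans (expand j a) (cong (λ n → suc (suc (n + a))) (sym (double≡+ j)))
    where
    expand : ∀ j a → j + suc (suc (j + a)) ≡ suc (suc (j + j + a))
    expand = ℕ-Solver.solve-∀
  x^d≡ : x ^ d ≡ q ^ suc b′ * q ^ suc a
  x^d≡ = begin
    x ^ d                                      ≡⟨ square-power q d ⟩
    q ^ double d                               ≡⟨ cong (q ^_) (double≡+ d) ⟩
    q ^ (d + d)                                ≡⟨ cong (q ^_) (expand j a) ⟩
    q ^ (suc (suc (suc (j + j + a))) + suc a)  ≡⟨ cong (λ n → q ^ (suc (suc (suc (n + a))) + suc a)) (double≡+ j) ⟨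
    q ^ (suc b′ + suc a)                       ≡⟨ ℕₚ.^-distribˡ-+-* q (suc b′) (suc a) ⟩
    q ^ suc b′ * q ^ suc a                     ∎
    where
    expand : ∀ j a → suc (suc (j + a)) + suc (suc (j + a)) ≡ suc (suc (suc (j + j + a))) + suc a
    expand = ℕ-Solver.solve-∀
  rearrange : ∀ Y Z G₁ G₂ V → (Y * Z * G₁ + G₂) * V ≡ G₂ * V + Y * (G₁ * (V * Z))
  rearrange = ℕ-Solver.solve-∀

closedForm-same : ∀ q b a → parity b ≡ parity a
  → closedForm q (suc b) a ≡ closedForm q b a + q ^ suc b * closedForm q b (suc a)
closedForm-same q b a e with position b a
... | below-diff k a = ⊥-elim (parity-suc-≢ a (trans (sym (parity-shift k a)) e))
... | above-diff m b = ⊥-elim (parity-suc-≢ b (sym (trans e (parity-shift m b))))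
... | above-same m b =
  closedForm-vanishing q (s≤s (s≤s (ℕₚ.m≤n+m b (double m)))) (s≤s (ℕₚ.m≤n⇒m≤1+n (ℕₚ.m≤n⇒m≤1+n (ℕₚ.m≤n+m b (double m)))))
... | below-same zero a = closedForm-same-diagonal q a
... | below-same (suc j) a = closedForm-same-below q j a

-- the case a = b + 1: only the second term survives
closedForm-diff-diagonal : ∀ q b → closedForm q (suc b) (suc b) ≡ closedForm q b (suc b) + q ^ suc b * closedForm q b b
closedForm-diff-diagonal q b = begin
  closedForm q (suc b) (suc b)                      ≡⟨ closedForm-even q 0 (suc b) refl ⟩
  1 * W (suc b)                                     ≡⟨ ℕₚ.*-identityˡ _ ⟩
  W (suc b)                                         ≡⟨ coreWeight-suc q b ⟩
  W b * q ^ suc b                                   ≡⟨ ℕₚ.*-comm (W b) _ ⟩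
  q ^ suc b * W b                                   ≡⟨ cong (λ v → q ^ suc b * v) closedForm-diagonal ⟨
  q ^ suc b * closedForm q b b                      ≡⟨ cong (λ v → v + q ^ suc b * closedForm q b b) (closedForm-above q (ℕₚ.n<1+n b)) ⟨
  closedForm q b (suc b) + q ^ suc b * closedForm q b b ∎
  where
  open ≡-Reasoning
  W = coreWeight q
  closedForm-diagonal : closedForm q b b ≡ W b
  closedForm-diagonal = trans (closedForm-even q 0 b refl) (trans (cong (_* W b) (gauss-zero (q ^ 2) b)) (ℕₚ.*-identityˡ _))

-- the case a = 0, b = 2k + 1: the first q-Pascal rule and [2k+1, k+1] = [2k+1, k]
closedForm-diff-empty-core : ∀ q k
  → closedForm q (suc (suc (double k + 0))) 0
    ≡ closedForm q (suc (double k + 0)) 0 + q ^ suc (suc (double k + 0)) * closedForm q (suc (double k + 0)) 0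
closedForm-diff-empty-core q k = begin
  closedForm q (suc b′) 0                                ≡⟨ closedForm-even q (suc k) 0 refl ⟩
  (gauss x b′ k + x ^ suc k * gauss x b′ (suc k)) * W 0  ≡⟨ cong₂ (λ y g → (gauss x b′ k + y * g) * W 0) x^k≡ (gauss-symmetric x (suc k) k k+k≡b′) ⟩
  (gauss x b′ k + q ^ suc b′ * gauss x b′ k) * W 0       ≡⟨ rearrange (gauss x b′ k) (q ^ suc b′) (W 0) ⟩
  gauss x b′ k * W 0 + q ^ suc b′ * (gauss x b′ k * W 0) ≡⟨ cong (λ v → v + q ^ suc b′ * v) (closedForm-odd q k 0 refl) ⟨
  closedForm q b′ 0 + q ^ suc b′ * closedForm q b′ 0     ∎
  where
  open ≡-Reasoning
  x = q ^ 2
  W = coreWeight q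
  b′ = suc (double k + 0)
  k+k≡b′ : suc k + k ≡ b′
  k+k≡b′ = cong suc (trans (sym (double≡+ k)) (sym (ℕₚ.+-identityʳ (double k))))
  x^k≡ : x ^ suc k ≡ q ^ suc b′
  x^k≡ = trans (square-power q (suc k)) (cong (λ n → q ^ suc (suc n)) (sym (ℕₚ.+-identityʳ (double k))))
  rearrange : ∀ G Y V → (G + Y * G) * V ≡ G * V + Y * (G * V)
  rearrange = ℕ-Solver.solve-∀

-- the case a ≥ 1, b = a + 2k + 1: the first q-Pascal rule
closedForm-diff-below : ∀ q k a
  → closedForm q (suc (suc (double k + suc a))) (suc a)
    ≡ closedForm q (suc (double k + suc a)) (suc a) + q ^ suc (suc (double k + suc a)) * closedForm q (suc (double k + suc a)) a
closedForm-diff-below q k a = begin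
  closedForm q (suc b′) (suc a)                                      ≡⟨ closedForm-even q (suc k) (suc a) refl ⟩
  (gauss x b′ k + x ^ suc k * gauss x b′ (suc k)) * W (suc a)
    ≡⟨ cong₂ (λ y w → (gauss x b′ k + y * gauss x b′ (suc k)) * w) (square-power q (suc k)) (coreWeight-suc q a) ⟩
  (gauss x b′ k + q ^ double (suc k) * gauss x b′ (suc k)) * (W a * q ^ suc a)
    ≡⟨ rearrange (gauss x b′ k) (gauss x b′ (suc k)) (q ^ double (suc k)) (W a) (q ^ suc a) ⟩
  gauss x b′ k * (W a * q ^ suc a) + q ^ double (suc k) * q ^ suc a * (gauss x b′ (suc k) * W a)
    ≡⟨ cong₂ (λ w y → gauss x b′ k * w + y * (gauss x b′ (suc k) * W a)) (coreWeight-suc q a) (ℕₚ.^-distribˡ-+-* q (double (suc k)) (suc a)) ⟨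
  gauss x b′ k * W (suc a) + q ^ suc b′ * (gauss x b′ (suc k) * W a)
    ≡⟨ cong₂ (λ u v → u + q ^ suc b′ * v) (closedForm-odd q k (suc a) refl) (closedForm-even q (suc k) a (cong suc (sym (ℕₚ.+-suc (double k) a)))) ⟨
  closedForm q b′ (suc a) + q ^ suc b′ * closedForm q b′ a           ∎
  where
  open ≡-Reasoning
  x = q ^ 2
  W = coreWeight q
  b′ = suc (double k + suc a)
  rearrange : ∀ G₁ G₂ Y V Z → (G₁ + Y * G₂) * (V * Z) ≡ G₁ * (V * Z) + Y * Z * (G₂ * V)
  rearrange = ℕ-Solver.solve-∀

closedForm-diff : ∀ q b a → parity b ≡ parity (suc a)
  → closedForm q (suc b) a ≡ closedForm q b a + q ^ suc b * closedForm q b (pred a)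
closedForm-diff q b a e with position b a
... | below-same k a = ⊥-elim (parity-suc-≢ a (sym (trans (sym (parity-double+ k a)) e)))
... | above-same m b = ⊥-elim (parity-suc-≢ b (sym (trans e (parity-shift m b))))
... | above-diff (suc m) b =
  closedForm-vanishing q (s≤s (s≤s (ℕₚ.m≤n⇒m≤1+n (ℕₚ.m≤n+m b (double m))))) (s≤s (ℕₚ.m≤n⇒m≤1+n (ℕₚ.m≤n+m b (double m))))
... | above-diff zero b = closedForm-diff-diagonal q b
... | below-diff k zero = closedForm-diff-empty-core q k
... | below-diff k (suc a) = closedForm-diff-below q k a

coreGenFun≡closedForm : ∀ q b a → coreGenFun q b a ≡ closedForm q b a
coreGenFun≡closedForm q zero zero    = refl
coreGenFun≡closedForm q zero (suc a) =
  trans (strict-zero-empty q (coreCharge (suc a)) (λ e → nonzero (coreCharge-injective {suc a} {0} e)))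
        (sym (closedForm-above q {0} {suc a} (s≤s z≤n)))
  where
  nonzero : suc a ≢ 0
  nonzero ()
coreGenFun≡closedForm q (suc b) a with parity-dichotomy b a
... | inj₁ e = begin
  coreGenFun q (suc b) a                                ≡⟨ coreGenFun-same q b a e ⟩
  coreGenFun q b a + q ^ suc b * coreGenFun q b (suc a)
    ≡⟨ cong₂ (λ u v → u + q ^ suc b * v) (coreGenFun≡closedForm q b a) (coreGenFun≡closedForm q b (suc a)) ⟩
  closedForm q b a + q ^ suc b * closedForm q b (suc a) ≡⟨ closedForm-same q b a e ⟨
  closedForm q (suc b) a                                ∎
  where open ≡-Reasoning
... | inj₂ e = begin
  coreGenFun q (suc b) a                                 ≡⟨ coreGenFun-diff q b a e ⟩
  coreGenFun q b a + q ^ suc b * coreGenFun q b (pred a)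
    ≡⟨ cong₂ (λ u v → u + q ^ suc b * v) (coreGenFun≡closedForm q b a) (coreGenFun≡closedForm q b (pred a)) ⟩
  closedForm q b a + q ^ suc b * closedForm q b (pred a) ≡⟨ closedForm-diff q b a e ⟨
  closedForm q (suc b) a                                 ∎
  where open ≡-Reasoning

lemma5p14 : (a b : ℕ) (L : List (List ℕ)) → Unique L
    → (∀ λ' → (λ' ∈ L) ⇔ (DistinctPartsAtMost b λ' × TwoCore λ' (staircase a)))
    → (q : ℕ)
    → sum (map (λ λ' → q ^ size λ') L)
      ≡ gaussℤ (q ^ 2) b ((+ b - + a) /ℕ 2) * q ^ (suc a C 2)
lemma5p14 a b L unique-L L-spec q = begin
  weight q L        ≡⟨ sum-map-set-equal (λ ν → q ^ size ν) unique-L (strict-unique b (coreCharge a)) same-members ⟩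
  coreGenFun q b a  ≡⟨ coreGenFun≡closedForm q b a ⟩
  closedForm q b a  ∎
  where
  open ≡-Reasoning
  -- L and the enumeration have the same members, by the charge criterion for 2-cores
  same-members : ∀ ν → (ν ∈ L) ⇔ (ν ∈ strict b (coreCharge a))
  same-members ν = mk⇔
    (λ ν∈L → let (distinct , core) = Equivalence.to (L-spec ν) ν∈L
             in strict⇐ b _ ν distinct (twoCore⇒charge (distinct⇒partition distinct) core))
    (λ ν∈ → let (distinct , e) = strict⇒ b _ ν ν∈
            in Equivalence.from (L-spec ν) (distinct , charge⇒twoCore (distinct⇒partition distinct) e))
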